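{- For $S=\sqrt{2}$, $P_S<1.785975$.
   Context: A set system over $[n]$ is a family $\mathcal{F}\subseteq 2^{[n]}$. A maximal chain of $\mathcal{F}$ is a sequence $S_0\subsetneq\dots\subsetneq S_n$ of members of $\mathcal{F}$; $C(\mathcal{F})$ is their number. $S(\mathcal{F})=|\mathcal{F}|^{1/n}$; $P(\mathcal{F})=(n!/C(\mathcal{F}))^{1/n}$ if $C(\mathcal{F})>0$ and $+\infty$ otherwise. For $1<S\le2$, $P_S=\inf\{P(\mathcal{F}): S(\mathcal{F})\le S\}$ over set systems on any ground set $[n]$. -}

module Defs where

open import Data.Nat using (ℕ; _!; zero; suc; _+_; _*_; _^_; _≤_; _<_)
open import Data.Bool using (Bool; true; false; if_then_else_)
open import Data.List using (List; []; _∷_; _++_; map; filter; length)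
open import Data.Nat.ListAction using (sum)
open import Data.Vec using ([]; _∷_)
open import Data.Fin.Subset using (Subset; inside; outside)
open import Data.Fin.Subset.Properties using (_⊂?_)
open import Data.Product using (Σ; _×_)
open import Relation.Nullary.Decidable using (⌊_⌋)

SetSystem : ℕ → Set
SetSystem n = Subset n → Bool

allSubsets : (n : ℕ) → List (Subset n)
allSubsets zero    = [] ∷ []
allSubsets (suc n) = map (outside ∷_) (allSubsets n) ++ map (inside ∷_) (allSubsets n)

card : {n : ℕ} → SetSystem n → ℕ
card {n} F = length (filter (λ A → F A Data.Bool.≟ true) (allSubsets n))
  where import Data.Bool

-- chainsEndingAt F m T = number of sequences S₀ ⊊ S₁ ⊊ … ⊊ S_m = T
-- with every Sᵢ ∈ F.
chainsEndingAt : {n : ℕ} → SetSystem n → ℕ → Subset n → ℕ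
chainsEndingAt F zero    T = if F T then 1 else 0
chainsEndingAt {n} F (suc m) T =
  if F T
  then sum (map (λ S → if ⌊ S ⊂? T ⌋ then chainsEndingAt F m S else 0) (allSubsets n))
  else 0

-- C(F): number of maximal chains S₀ ⊊ S₁ ⊊ … ⊊ S_n of members of F.
numMaxChains : {n : ℕ} → SetSystem n → ℕ
numMaxChains {n} F = sum (map (chainsEndingAt F n) (allSubsets n))

-- P_S < c with S = √2, c = 1785975 / 10^6, unfolded:
-- there is a set system F on [n], n ≥ 1, with S(F) = |F|^{1/n} ≤ √2
-- (i.e. |F|^2 ≤ 2^n) and P(F) = (n!/C(F))^{1/n} < c
-- (i.e. n! · 10^{6n} < C(F) · 1785975^n; this forces C(F) > 0).

{-# OPTIONS --safe #-}
module Submission where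

-- Split [240] into three blocks of 80 and let F consist of the sets whose block sizes (i, j, k)
-- satisfy C(80,i) C(80,j) C(80,k) ≤ threshold.  Permuting each block preserves F, so the number Φ(i, j, k) of chains
-- ending at a set depends only on its block sizes; a chain ending at T extends one ending at some
-- T minus one element, so Φ(i, j, k) = i Φ(i-1, j, k) + j Φ(i, j-1, k) + k Φ(i, j, k-1) on accepted
-- triples (Φ(0, 0, 0) = 1, and Φ = 0 off F).  Both |F|² ≤ 2²⁴⁰ and
-- 240! · 10^(6·240) < Φ(80, 80, 80) · 1785975²⁴⁰ then follow by evaluating these formulas, the
-- latter by tabulating Φ over the 81³ triples.

open import Algebra.Properties.CommutativeSemigroup using (interchange)
open import Data.Bool using (Bool; true; false; if_then_else_)
import Data.Bool as Bool
open import Data.Fin.Subset using (Subset; inside; outside; ∣_∣; ⊤)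
open import Data.Fin.Subset.Properties using (_⊆?_; _⊂?_; p⊆q⇒∣p∣≤∣q∣; p⊂q⇒∣p∣<∣q∣; ∣p∣≤n; ∣⊤∣≡n)
open import Data.List using (List; []; _∷_; map; filter; length)
open import Data.List.Properties using (map-++; map-∘; map-cong; map-cong-local)
open import Data.List.Relation.Unary.All as All using (All; []; _∷_)
open import Data.List.Relation.Unary.All.Properties using (map⁺)
open import Data.Nat using (ℕ; zero; suc; pred; _+_; _*_; _^_; _!; _≤_; _<_; _≤ᵇ_; z≤n; s≤s; s≤s⁻¹)
open import Data.Nat.ListAction using (sum)
open import Data.Nat.ListAction.Properties using (sum-++)
open import Data.Nat.Properties
  using ( +-identityʳ; *-identityˡ; +-assoc; +-suc; *-distribʳ-+; +-commutativeSemigroup; suc-injective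
        ; ≤-reflexive; m≤m+n; m≤n+m; n≤1+n; <-≤-trans; *-monoˡ-≤; ≤ᵇ⇒≤; <ᵇ⇒<; module ≤-Reasoning)
open import Data.Product using (Σ; _×_; _,_)
open import Data.Unit using (tt)
open import Data.Vec using (Vec; []; _∷_; _++_; take; drop)
open import Data.Vec.Properties using (take++drop≡id)
open import Defs
open import Function using (_∘_)
open import Relation.Binary.PropositionalEquality
open import Relation.Nullary.Decidable using (Dec; yes; no; does; isYes≗does)

-- Opaque so that no conversion check unfolds allSubsets on the concrete 240-element ground set.
opaque
  sumSubsets : (n : ℕ) → (Subset n → ℕ) → ℕ
  sumSubsets n g = sum (map g (allSubsets n))

  sum-allSubsets : ∀ n (g : Subset n → ℕ) → sum (map g (allSubsets n)) ≡ sumSubsets n g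
  sum-allSubsets n g = refl

  sumSubsets-[] : (g : Subset 0 → ℕ) → sumSubsets 0 g ≡ g []
  sumSubsets-[] g = +-identityʳ (g [])

  sumSubsets-∷ : ∀ n (g : Subset (suc n) → ℕ) →
    sumSubsets (suc n) g ≡ sumSubsets n (g ∘ (outside ∷_)) + sumSubsets n (g ∘ (inside ∷_))
  sumSubsets-∷ n g =
    trans (cong sum (map-++ g (map (outside ∷_) Sₙ) (map (inside ∷_) Sₙ)))
    (trans (sum-++ (map g (map (outside ∷_) Sₙ)) (map g (map (inside ∷_) Sₙ)))
           (sym (cong₂ _+_ (cong sum (map-∘ Sₙ)) (cong sum (map-∘ Sₙ)))))
    where
    Sₙ : List (Subset n)
    Sₙ = allSubsets n

sumSubsets-cong : ∀ n {g h : Subset n → ℕ} → (∀ S → g S ≡ h S) → sumSubsets n g ≡ sumSubsets n h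
sumSubsets-cong n {g} {h} g≗h =
  trans (sym (sum-allSubsets n g)) (trans (cong sum (map-cong g≗h (allSubsets n))) (sum-allSubsets n h))

sumSubsets-zero : ∀ n (g : Subset n → ℕ) → (∀ S → g S ≡ 0) → sumSubsets n g ≡ 0
sumSubsets-zero zero    g g≗0 = trans (sumSubsets-[] g) (g≗0 [])
sumSubsets-zero (suc n) g g≗0 = trans (sumSubsets-∷ n g)
  (cong₂ _+_ (sumSubsets-zero n _ (g≗0 ∘ (outside ∷_))) (sumSubsets-zero n _ (g≗0 ∘ (inside ∷_))))

term≤sumSubsets : ∀ {n} (g : Subset n → ℕ) S → g S ≤ sumSubsets n g
term≤sumSubsets g [] = ≤-reflexive (sym (sumSubsets-[] g))
term≤sumSubsets {suc n} g (outside ∷ S) = begin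
  g (outside ∷ S)                 ≤⟨ term≤sumSubsets (g ∘ (outside ∷_)) S ⟩
  sumSubsets n (g ∘ (outside ∷_)) ≤⟨ m≤m+n _ _ ⟩
  _                               ≡⟨ sumSubsets-∷ n g ⟨
  sumSubsets (suc n) g            ∎
  where open ≤-Reasoning
term≤sumSubsets {suc n} g (inside ∷ S) = begin
  g (inside ∷ S)                 ≤⟨ term≤sumSubsets (g ∘ (inside ∷_)) S ⟩
  sumSubsets n (g ∘ (inside ∷_)) ≤⟨ m≤n+m _ _ ⟩
  _                              ≡⟨ sumSubsets-∷ n g ⟨
  sumSubsets (suc n) g           ∎
  where open ≤-Reasoning

sumSubsets-++ : ∀ a {b} (g : Subset (a + b) → ℕ) →
  sumSubsets (a + b) g ≡ sumSubsets a (λ u → sumSubsets b (λ v → g (u ++ v)))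
sumSubsets-++ zero    g = sym (sumSubsets-[] _)
sumSubsets-++ (suc a) g = trans (sumSubsets-∷ (a + _) g)
  (trans (cong₂ _+_ (sumSubsets-++ a (g ∘ (outside ∷_))) (sumSubsets-++ a (g ∘ (inside ∷_))))
         (sym (sumSubsets-∷ a _)))

if-does-else-0 : ∀ {P : Set} (d : Dec P) {x : ℕ} → (P → x ≡ 0) → (if does d then x else 0) ≡ 0
if-does-else-0 (yes p) x≡0 = x≡0 p
if-does-else-0 (no _)  _   = refl

sumSubsets-⊆≡top : ∀ {n} (T : Subset n) (g : Subset n → ℕ) → (∀ S → ∣ S ∣ < ∣ T ∣ → g S ≡ 0) →
  sumSubsets n (λ S → if does (S ⊆? T) then g S else 0) ≡ g T
sumSubsets-⊆≡top [] g _ = sumSubsets-[] _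
sumSubsets-⊆≡top {suc n} (outside ∷ T) g small = trans (sumSubsets-∷ n _)
  (trans (cong₂ _+_ (sumSubsets-⊆≡top T (g ∘ (outside ∷_)) (small ∘ (outside ∷_)))
                    (sumSubsets-zero n _ λ _ → refl))
         (+-identityʳ _))
sumSubsets-⊆≡top {suc n} (inside ∷ T) g small = trans (sumSubsets-∷ n _)
  (cong₂ _+_ (sumSubsets-zero n _ λ S → if-does-else-0 (S ⊆? T) λ S⊆T →
                small (outside ∷ S) (s≤s (p⊆q⇒∣p∣≤∣q∣ S⊆T)))
             (sumSubsets-⊆≡top T (g ∘ (inside ∷_)) λ S ∣S∣<∣T∣ → small (inside ∷ S) (s≤s ∣S∣<∣T∣)))

removals : ∀ {n} → Subset n → List (Subset n)
removals []            = []
removals (outside ∷ p) = map (outside ∷_) (removals p)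
removals (inside  ∷ p) = (outside ∷ p) ∷ map (inside ∷_) (removals p)

removals-size : ∀ {n} (T : Subset n) → All (λ S → suc ∣ S ∣ ≡ ∣ T ∣) (removals T)
removals-size []            = []
removals-size (outside ∷ T) = map⁺ (removals-size T)
removals-size (inside  ∷ T) = refl ∷ map⁺ (All.map (cong suc) (removals-size T))

sumSubsets-⊂≡sum-removals : ∀ {n} (T : Subset n) (g : Subset n → ℕ) → (∀ S → suc ∣ S ∣ < ∣ T ∣ → g S ≡ 0) →
  sumSubsets n (λ S → if does (S ⊂? T) then g S else 0) ≡ sum (map g (removals T))
sumSubsets-⊂≡sum-removals [] g _ = sumSubsets-[] _
sumSubsets-⊂≡sum-removals {suc n} (outside ∷ T) g small = trans (sumSubsets-∷ n _)
  (trans (cong₂ _+_ (sumSubsets-⊂≡sum-removals T (g ∘ (outside ∷_)) (small ∘ (outside ∷_)))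
                    (sumSubsets-zero n _ λ _ → refl))
         (trans (+-identityʳ _) (cong sum (map-∘ (removals T)))))
sumSubsets-⊂≡sum-removals {suc n} (inside ∷ T) g small = trans (sumSubsets-∷ n _)
  (cong₂ _+_ (sumSubsets-⊆≡top T (g ∘ (outside ∷_)) λ S ∣S∣<∣T∣ → small (outside ∷ S) (s≤s ∣S∣<∣T∣))
             (trans (sumSubsets-⊂≡sum-removals T (g ∘ (inside ∷_)) λ S lt → small (inside ∷ S) (s≤s lt))
                    (cong sum (map-∘ (removals T)))))

chainsEndingAt-suc : ∀ {n} (F : SetSystem n) k T → chainsEndingAt F (suc k) T ≡
  (if F T then sumSubsets n (λ S → if does (S ⊂? T) then chainsEndingAt F k S else 0) else 0)
chainsEndingAt-suc {n} F k T = cong (λ s → if F T then s else 0)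
  (trans (cong sum (map-cong (λ S → cong (λ b → if b then chainsEndingAt F k S else 0) (isYes≗does (S ⊂? T)))
                             (allSubsets n)))
         (sum-allSubsets n _))

chainsEndingAt-small : ∀ {n} (F : SetSystem n) k S → ∣ S ∣ < k → chainsEndingAt F k S ≡ 0
chainsEndingAt-small {n} F (suc k) S ∣S∣<1+k rewrite chainsEndingAt-suc F k S with F S
... | false = refl
... | true  = sumSubsets-zero n _ λ R → if-does-else-0 (R ⊂? S) λ R⊂S →
  chainsEndingAt-small F k R (<-≤-trans (p⊂q⇒∣p∣<∣q∣ R⊂S) (s≤s⁻¹ ∣S∣<1+k))

-- A chain of length k + 1 ending at a set of size k + 1 loses exactly one element per step, so its
-- second-to-last member is a removal of T.
chainsEndingAt-removals : ∀ {n} (F : SetSystem n) k T → ∣ T ∣ ≡ suc k →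
  chainsEndingAt F (suc k) T ≡ (if F T then sum (map (chainsEndingAt F k) (removals T)) else 0)
chainsEndingAt-removals F k T ∣T∣≡1+k = trans (chainsEndingAt-suc F k T)
  (cong (λ s → if F T then s else 0) (sumSubsets-⊂≡sum-removals T (chainsEndingAt F k) λ S lt →
    chainsEndingAt-small F k S (s≤s⁻¹ (subst (suc (suc ∣ S ∣) ≤_) ∣T∣≡1+k lt))))

startOrExtend : ℕ → ℕ → ℕ
startOrExtend zero    _ = 1
startOrExtend (suc _) s = s

chainsEndingAt-unique : ∀ {n} (F : SetSystem n) (Ψ : Subset n → ℕ) →
  (∀ T → Ψ T ≡ (if F T then startOrExtend ∣ T ∣ (sum (map Ψ (removals T))) else 0)) →
  ∀ T → chainsEndingAt F ∣ T ∣ T ≡ Ψ T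
chainsEndingAt-unique F Ψ rec T = go ∣ T ∣ T refl
  where
  at-size : ∀ {T m} → ∣ T ∣ ≡ m → Ψ T ≡ (if F T then startOrExtend m (sum (map Ψ (removals T))) else 0)
  at-size {T} refl = rec T

  go : ∀ k T → ∣ T ∣ ≡ k → chainsEndingAt F k T ≡ Ψ T
  go zero    T ∣T∣≡0   = sym (at-size ∣T∣≡0)
  go (suc k) T ∣T∣≡1+k = begin
    chainsEndingAt F (suc k) T                                       ≡⟨ chainsEndingAt-removals F k T ∣T∣≡1+k ⟩
    (if F T then sum (map (chainsEndingAt F k) (removals T)) else 0) ≡⟨ cong (λ s → if F T then sum s else 0) by-size ⟩
    (if F T then sum (map Ψ (removals T)) else 0)                    ≡⟨ at-size ∣T∣≡1+k ⟨
    Ψ T                                                              ∎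
    where
    open ≡-Reasoning
    by-size : map (chainsEndingAt F k) (removals T) ≡ map Ψ (removals T)
    by-size = map-cong-local (All.map (λ e → go k _ (suc-injective (trans e ∣T∣≡1+k))) (removals-size T))

chainsEndingAt≤numMaxChains : ∀ {n} (F : SetSystem n) T → ∣ T ∣ ≡ n → chainsEndingAt F ∣ T ∣ T ≤ numMaxChains F
chainsEndingAt≤numMaxChains {n} F T ∣T∣≡n = subst (λ m → chainsEndingAt F m T ≤ numMaxChains F) (sym ∣T∣≡n)
  (subst (chainsEndingAt F n T ≤_) (sym (sum-allSubsets n _)) (term≤sumSubsets (chainsEndingAt F n) T))

take-++ : ∀ {A : Set} {m n} (u : Vec A m) (v : Vec A n) → take m (u ++ v) ≡ u
take-++ []      v = refl
take-++ (x ∷ u) v = cong (x ∷_) (take-++ u v)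

drop-++ : ∀ {A : Set} {m n} (u : Vec A m) (v : Vec A n) → drop m (u ++ v) ≡ v
drop-++ []      v = refl
drop-++ (x ∷ u) v = drop-++ u v

∣p++q∣≡∣p∣+∣q∣ : ∀ {m n} (p : Subset m) (q : Subset n) → ∣ p ++ q ∣ ≡ ∣ p ∣ + ∣ q ∣
∣p++q∣≡∣p∣+∣q∣ []            q = refl
∣p++q∣≡∣p∣+∣q∣ (outside ∷ p) q = ∣p++q∣≡∣p∣+∣q∣ p q
∣p++q∣≡∣p∣+∣q∣ (inside  ∷ p) q = cong suc (∣p++q∣≡∣p∣+∣q∣ p q)

atBlockSizes : ∀ a b {c} {A : Set} → (ℕ → ℕ → ℕ → A) → Subset (a + (b + c)) → A
atBlockSizes a b G T = G (∣ take a T ∣) (∣ take b (drop a T) ∣) (∣ drop b (drop a T) ∣)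

atBlockSizes-++ : ∀ {a b c} {A : Set} (G : ℕ → ℕ → ℕ → A) (u : Subset a) (v : Subset b) (w : Subset c) →
  atBlockSizes a b G (u ++ (v ++ w)) ≡ G (∣ u ∣) (∣ v ∣) (∣ w ∣)
atBlockSizes-++ G u v w rewrite take-++ u (v ++ w) | drop-++ u (v ++ w) | take-++ v w | drop-++ v w = refl

blocks-elim : ∀ a b {c} (P : Subset (a + (b + c)) → Set) → (∀ u v w → P (u ++ (v ++ w))) → ∀ T → P T
blocks-elim a b P p T = subst P (trans (cong (take a T ++_) (take++drop≡id b (drop a T))) (take++drop≡id a T))
                                (p (take a T) (take b (drop a T)) (drop b (drop a T)))

sum-removals-++ : ∀ {m n} (f : Subset (m + n) → ℕ) (u : Subset m) (v : Subset n) →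
  sum (map f (removals (u ++ v))) ≡ sum (map (f ∘ (_++ v)) (removals u)) + sum (map (f ∘ (u ++_)) (removals v))
sum-removals-++ f [] v = refl
sum-removals-++ f (outside ∷ u) v = begin
  sum (map f (map (outside ∷_) (removals (u ++ v))))             ≡⟨ cong sum (map-∘ (removals (u ++ v))) ⟨
  sum (map (f ∘ (outside ∷_)) (removals (u ++ v)))               ≡⟨ sum-removals-++ (f ∘ (outside ∷_)) u v ⟩
  sum (map (f ∘ (outside ∷_) ∘ (_++ v)) (removals u)) + rest     ≡⟨ cong (λ s → sum s + rest) (map-∘ (removals u)) ⟩
  sum (map (f ∘ (_++ v)) (map (outside ∷_) (removals u))) + rest ∎
  where
  open ≡-Reasoning
  rest : ℕ
  rest = sum (map (f ∘ ((outside ∷ u) ++_)) (removals v))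
sum-removals-++ f (inside ∷ u) v = begin
  first + sum (map f (map (inside ∷_) (removals (u ++ v))))              ≡⟨ cong (λ s → first + sum s) (map-∘ (removals (u ++ v))) ⟨
  first + sum (map (f ∘ (inside ∷_)) (removals (u ++ v)))                ≡⟨ cong (first +_) (sum-removals-++ (f ∘ (inside ∷_)) u v) ⟩
  first + (sum (map (f ∘ (inside ∷_) ∘ (_++ v)) (removals u)) + rest)    ≡⟨ +-assoc first _ rest ⟨
  first + sum (map (f ∘ (inside ∷_) ∘ (_++ v)) (removals u)) + rest      ≡⟨ cong (λ s → first + sum s + rest) (map-∘ (removals u)) ⟩
  first + sum (map (f ∘ (_++ v)) (map (inside ∷_) (removals u))) + rest  ∎
  where
  open ≡-Reasoning
  first rest : ℕ
  first = f (outside ∷ u ++ v)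
  rest  = sum (map (f ∘ ((inside ∷ u) ++_)) (removals v))

sum-removals-size : ∀ {n} (G : ℕ → ℕ) (u : Subset n) → sum (map (G ∘ ∣_∣) (removals u)) ≡ ∣ u ∣ * G (pred ∣ u ∣)
sum-removals-size G []            = refl
sum-removals-size G (outside ∷ u) = trans (cong sum (sym (map-∘ (removals u)))) (sum-removals-size G u)
sum-removals-size G (inside  ∷ u) = cong (G ∣ u ∣ +_)
  (trans (cong sum (sym (map-∘ (removals u)))) (trans (sum-removals-size (G ∘ suc) u) (*-suc-pred ∣ u ∣)))
  where
  *-suc-pred : ∀ m → m * G (suc (pred m)) ≡ m * G m
  *-suc-pred zero    = refl
  *-suc-pred (suc m) = refl

ChainRecurrence : ∀ a b c → (ℕ → ℕ → ℕ → Bool) → (ℕ → ℕ → ℕ → ℕ) → Set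
ChainRecurrence a b c acc Φ = ∀ {i j k} → i ≤ a → j ≤ b → k ≤ c →
  Φ i j k ≡ (if acc i j k
             then startOrExtend (i + (j + k)) (i * Φ (pred i) j k + (j * Φ i (pred j) k + k * Φ i j (pred k)))
             else 0)

chainsEndingAt-blocks : ∀ {a b c acc Φ} → ChainRecurrence a b c acc Φ →
  ∀ T → chainsEndingAt (atBlockSizes a b acc) (∣ T ∣) T ≡ atBlockSizes a b Φ T
chainsEndingAt-blocks {a} {b} {c} {acc} {Φ} rec =
  chainsEndingAt-unique (atBlockSizes a b acc) Ψ (blocks-elim a b _ recurrence)
  where
  Ψ : Subset (a + (b + c)) → ℕ
  Ψ = atBlockSizes a b Φ

  sum-removals : ∀ u v w → sum (map Ψ (removals (u ++ (v ++ w)))) ≡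
    ∣ u ∣ * Φ (pred ∣ u ∣) (∣ v ∣) (∣ w ∣) + (∣ v ∣ * Φ (∣ u ∣) (pred ∣ v ∣) (∣ w ∣) + ∣ w ∣ * Φ (∣ u ∣) (∣ v ∣) (pred ∣ w ∣))
  sum-removals u v w =
    trans (sum-removals-++ Ψ u (v ++ w))
    (cong₂ _+_ (trans (cong sum (map-cong (λ u′ → atBlockSizes-++ Φ u′ v w) (removals u)))
                      (sum-removals-size (λ i → Φ i (∣ v ∣) (∣ w ∣)) u))
    (trans (sum-removals-++ (Ψ ∘ (u ++_)) v w)
    (cong₂ _+_ (trans (cong sum (map-cong (λ v′ → atBlockSizes-++ Φ u v′ w) (removals v)))
                      (sum-removals-size (λ j → Φ (∣ u ∣) j (∣ w ∣)) v))
               (trans (cong sum (map-cong (λ w′ → atBlockSizes-++ Φ u v w′) (removals w)))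
                      (sum-removals-size (λ k → Φ (∣ u ∣) (∣ v ∣) k) w)))))

  recurrence : ∀ u v w → let T = u ++ (v ++ w) in
    Ψ T ≡ (if atBlockSizes a b acc T then startOrExtend (∣ T ∣) (sum (map Ψ (removals T))) else 0)
  recurrence u v w = begin
    Ψ (u ++ (v ++ w))         ≡⟨ atBlockSizes-++ Φ u v w ⟩
    Φ (∣ u ∣) (∣ v ∣) (∣ w ∣) ≡⟨ rec (∣p∣≤n u) (∣p∣≤n v) (∣p∣≤n w) ⟩
    _                         ≡⟨ cong₂ (λ p s → if p then s else 0) (sym (atBlockSizes-++ acc u v w))
                                       (cong₂ startOrExtend size (sym (sum-removals u v w))) ⟩
    _                         ∎
    where
    open ≡-Reasoning
    size : ∣ u ∣ + (∣ v ∣ + ∣ w ∣) ≡ ∣ u ++ (v ++ w) ∣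
    size = sym (trans (∣p++q∣≡∣p∣+∣q∣ u (v ++ w)) (cong (∣ u ∣ +_) (∣p++q∣≡∣p∣+∣q∣ v w)))

lookupOr : ∀ {A : Set} → A → List A → ℕ → A
lookupOr d []       i       = d
lookupOr d (x ∷ xs) zero    = x
lookupOr d (x ∷ xs) (suc i) = lookupOr d xs i

length-filter≡sum : ∀ {A : Set} (P : A → Bool) xs →
  length (filter (λ x → P x Bool.≟ true) xs) ≡ sum (map (λ x → if P x then 1 else 0) xs)
length-filter≡sum P []       = refl
length-filter≡sum P (x ∷ xs) with P x
... | true  = cong suc (length-filter≡sum P xs)
... | false = length-filter≡sum P xs

card≡sumSubsets : ∀ {n} (F : SetSystem n) → card F ≡ sumSubsets n (λ T → if F T then 1 else 0)
card≡sumSubsets {n} F = trans (length-filter≡sum F (allSubsets n)) (sum-allSubsets n _)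

_⊕_ : List ℕ → List ℕ → List ℕ
[]       ⊕ ys       = ys
(x ∷ xs) ⊕ []       = x ∷ xs
(x ∷ xs) ⊕ (y ∷ ys) = x + y ∷ xs ⊕ ys

length-⊕ : ∀ xs ys → length xs ≤ length ys → length (xs ⊕ ys) ≡ length ys
length-⊕ []       ys       _           = refl
length-⊕ (x ∷ xs) (y ∷ ys) (s≤s ∣xs∣≤∣ys∣) = cong suc (length-⊕ xs ys ∣xs∣≤∣ys∣)

-- Opaque so that binomial rows, and the sums and tables built from them, are evaluated only by the
-- numeric checks at the end.
opaque
  pascalRow : ℕ → List ℕ
  pascalRow zero    = 1 ∷ []
  -- nextRow receives the previous row as one shared argument; writing pascalRow n twice would
  -- make the evaluation take time 2ⁿ.
  pascalRow (suc n) = nextRow (pascalRow n)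
    where
    nextRow : List ℕ → List ℕ
    nextRow xs = xs ⊕ (0 ∷ xs)

  pascalRow-zero : pascalRow 0 ≡ 1 ∷ []
  pascalRow-zero = refl

  pascalRow-suc : ∀ n → pascalRow (suc n) ≡ pascalRow n ⊕ (0 ∷ pascalRow n)
  pascalRow-suc n = refl

length-pascalRow : ∀ n → length (pascalRow n) ≡ suc n
length-pascalRow zero    = cong length pascalRow-zero
length-pascalRow (suc n) = trans (cong length (pascalRow-suc n))
  (trans (length-⊕ (pascalRow n) (0 ∷ pascalRow n) (n≤1+n _)) (cong suc (length-pascalRow n)))

indexWeightedSum : List ℕ → (ℕ → ℕ) → ℕ
indexWeightedSum []       G = 0
indexWeightedSum (w ∷ ws) G = w * G 0 + indexWeightedSum ws (G ∘ suc)

indexWeightedSum-cong : ∀ ws {G H : ℕ → ℕ} → (∀ i → G i ≡ H i) → indexWeightedSum ws G ≡ indexWeightedSum ws H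
indexWeightedSum-cong []       G≗H = refl
indexWeightedSum-cong (w ∷ ws) G≗H = cong₂ _+_ (cong (w *_) (G≗H 0)) (indexWeightedSum-cong ws (G≗H ∘ suc))

indexWeightedSum-⊕ : ∀ xs ys G → indexWeightedSum (xs ⊕ ys) G ≡ indexWeightedSum xs G + indexWeightedSum ys G
indexWeightedSum-⊕ []       ys       G = refl
indexWeightedSum-⊕ (x ∷ xs) []       G = sym (+-identityʳ _)
indexWeightedSum-⊕ (x ∷ xs) (y ∷ ys) G = begin
  (x + y) * G 0 + indexWeightedSum (xs ⊕ ys) (G ∘ suc)
    ≡⟨ cong₂ _+_ (*-distribʳ-+ (G 0) x y) (indexWeightedSum-⊕ xs ys (G ∘ suc)) ⟩
  (x * G 0 + y * G 0) + (indexWeightedSum xs (G ∘ suc) + indexWeightedSum ys (G ∘ suc))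
    ≡⟨ interchange +-commutativeSemigroup (x * G 0) (y * G 0) _ _ ⟩
  (x * G 0 + indexWeightedSum xs (G ∘ suc)) + (y * G 0 + indexWeightedSum ys (G ∘ suc))
    ∎
  where open ≡-Reasoning

selfWeightedSum : List ℕ → (ℕ → ℕ) → ℕ
selfWeightedSum ws H = sum (map (λ w → w * H w) ws)

indexWeightedSum-lookup : ∀ ws (H : ℕ → ℕ) → indexWeightedSum ws (H ∘ lookupOr 0 ws) ≡ selfWeightedSum ws H
indexWeightedSum-lookup []       H = refl
indexWeightedSum-lookup (w ∷ ws) H = cong (w * H w +_) (indexWeightedSum-lookup ws H)

sumSubsets-size : ∀ n (G : ℕ → ℕ) → sumSubsets n (G ∘ ∣_∣) ≡ indexWeightedSum (pascalRow n) G
sumSubsets-size zero    G = trans (sumSubsets-[] _)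
  (sym (trans (cong (λ r → indexWeightedSum r G) pascalRow-zero) (trans (+-identityʳ _) (*-identityˡ (G 0)))))
sumSubsets-size (suc n) G = begin
  sumSubsets (suc n) (G ∘ ∣_∣)
    ≡⟨ sumSubsets-∷ n _ ⟩
  sumSubsets n (G ∘ ∣_∣) + sumSubsets n (G ∘ suc ∘ ∣_∣)
    ≡⟨ cong₂ _+_ (sumSubsets-size n G) (sumSubsets-size n (G ∘ suc)) ⟩
  indexWeightedSum (pascalRow n) G + indexWeightedSum (0 ∷ pascalRow n) G
    ≡⟨ indexWeightedSum-⊕ (pascalRow n) (0 ∷ pascalRow n) G ⟨
  indexWeightedSum (pascalRow n ⊕ (0 ∷ pascalRow n)) G
    ≡⟨ cong (λ r → indexWeightedSum r G) (pascalRow-suc n) ⟨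
  indexWeightedSum (pascalRow (suc n)) G
    ∎
  where open ≡-Reasoning

sumSubsets-blocks : ∀ a b c (G : ℕ → ℕ → ℕ → ℕ) → sumSubsets (a + (b + c)) (atBlockSizes a b G) ≡
  indexWeightedSum (pascalRow a) (λ i → indexWeightedSum (pascalRow b) (λ j → indexWeightedSum (pascalRow c) (G i j)))
sumSubsets-blocks a b c G =
  trans (sumSubsets-++ a _) (trans (sumSubsets-cong a inner) (sumSubsets-size a _))
  where
  inner : ∀ u → sumSubsets (b + c) (λ vw → atBlockSizes a b G (u ++ vw)) ≡
                indexWeightedSum (pascalRow b) (λ j → indexWeightedSum (pascalRow c) (G ∣ u ∣ j))
  inner u = begin
    sumSubsets (b + c) (λ vw → atBlockSizes a b G (u ++ vw))
      ≡⟨ sumSubsets-++ b _ ⟩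
    sumSubsets b (λ v → sumSubsets c (λ w → atBlockSizes a b G (u ++ (v ++ w))))
      ≡⟨ sumSubsets-cong b (λ v → sumSubsets-cong c (atBlockSizes-++ G u v)) ⟩
    sumSubsets b (λ v → sumSubsets c (λ w → G (∣ u ∣) (∣ v ∣) (∣ w ∣)))
      ≡⟨ sumSubsets-cong b (λ v → sumSubsets-size c (G (∣ u ∣) (∣ v ∣))) ⟩
    sumSubsets b (λ v → indexWeightedSum (pascalRow c) (G (∣ u ∣) (∣ v ∣)))
      ≡⟨ sumSubsets-size b _ ⟩
    indexWeightedSum (pascalRow b) (λ j → indexWeightedSum (pascalRow c) (G ∣ u ∣ j))
      ∎
    where open ≡-Reasoning

zipPadded : ∀ {A B : Set} → B → List A → List B → List (A × B)
zipPadded d []       ys       = []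
zipPadded d (x ∷ xs) []       = (x , d) ∷ zipPadded d xs []
zipPadded d (x ∷ xs) (y ∷ ys) = (x , y) ∷ zipPadded d xs ys

length-zipPadded : ∀ {A B : Set} (d : B) (xs : List A) ys → length (zipPadded d xs ys) ≡ length xs
length-zipPadded d []       ys       = refl
length-zipPadded d (x ∷ xs) []       = cong suc (length-zipPadded d xs [])
length-zipPadded d (x ∷ xs) (y ∷ ys) = cong suc (length-zipPadded d xs ys)

<-zipPadded : ∀ {A B : Set} (d : B) (xs : List A) ys {k} → k < length xs → k < length (zipPadded d xs ys)
<-zipPadded d xs ys {k} = subst (k <_) (sym (length-zipPadded d xs ys))

lookup-zipPadded : ∀ {A B : Set} (e : A) (d : B) xs ys {k} → k < length xs →
  lookupOr (e , d) (zipPadded d xs ys) k ≡ (lookupOr e xs k , lookupOr d ys k)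
lookup-zipPadded e d (x ∷ xs) []       {zero}  _          = refl
lookup-zipPadded e d (x ∷ xs) (y ∷ ys) {zero}  _          = refl
lookup-zipPadded e d (x ∷ xs) []       {suc k} (s≤s k<∣xs∣) = lookup-zipPadded e d xs [] k<∣xs∣
lookup-zipPadded e d (x ∷ xs) (y ∷ ys) {suc k} (s≤s k<∣xs∣) = lookup-zipPadded e d xs ys k<∣xs∣

module _ {A B : Set} (f : ℕ → B → A → A) where

  scanIndexed : ℕ → A → List B → List A
  scanIndexed i a []       = []
  -- As in pascalRow, the new entry is bound as an argument so that it is computed once.
  scanIndexed i a (b ∷ bs) = continue (f i b a)
    where
    continue : A → List A
    continue a′ = a′ ∷ scanIndexed (suc i) a′ bs

  lookup-scanIndexed : ∀ (d : A) (e : B) i a bs {k} → k < length bs →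
    lookupOr d (scanIndexed i a bs) k ≡ f (i + k) (lookupOr e bs k) (lookupOr d (a ∷ scanIndexed i a bs) k)
  lookup-scanIndexed d e i a (b ∷ bs) {zero}  _ = cong (λ m → f m b a) (sym (+-identityʳ i))
  lookup-scanIndexed d e i a (b ∷ bs) {suc k} (s≤s k<∣bs∣) =
    trans (lookup-scanIndexed d e (suc i) (f i b a) bs k<∣bs∣)
          (cong (λ m → f m (lookupOr e bs k) (lookupOr d (scanIndexed i a (b ∷ bs)) k)) (sym (+-suc i k)))

-- Tabulates, plane by plane and row by row, the solution of the recurrence in value-rec.  The labels
-- xs, ys, zs are handed to h along with the indices, so that no entry needs a list lookup.
module TabulatedRecurrence (h : ℕ → ℕ → ℕ → ℕ → ℕ → ℕ → ℕ → ℕ) (xs ys zs : List ℕ) where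

  row : ℕ → ℕ → ℕ → ℕ → List ℕ → List ℕ → List ℕ
  row i x j y behind below = scanIndexed cell 0 0 (zipPadded 0 (zipPadded 0 zs behind) below)
    where
    cell : ℕ → (ℕ × ℕ) × ℕ → ℕ → ℕ
    cell k ((z , p) , q) left = h i j k x y z (i * p + (j * q + k * left))

  plane : ℕ → ℕ → List (List ℕ) → List (List ℕ)
  plane i x behind = scanIndexed (λ j (y , b) below → row i x j y b below) 0 [] (zipPadded [] ys behind)

  table : List (List (List ℕ))
  table = scanIndexed plane 0 [] xs

  value : ℕ → ℕ → ℕ → ℕ
  value i j k = lookupOr 0 (lookupOr [] (lookupOr [] table i) j) k

  value-rec : ∀ {i j k} → i < length xs → j < length ys → k < length zs →
    value i j k ≡ h i j k (lookupOr 0 xs i) (lookupOr 0 ys j) (lookupOr 0 zs k)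
                    (i * value (pred i) j k + (j * value i (pred j) k + k * value i j (pred k)))
  value-rec {i} {j} {k} i< j< k< = begin
    value i j k                                            ≡⟨ cong (λ P → lookupOr 0 (lookupOr [] P j) k) table-at ⟩
    lookupOr 0 (lookupOr [] (plane i x P) j) k             ≡⟨ cong (λ R → lookupOr 0 R k) plane-at ⟩
    lookupOr 0 (row i x j y (lookupOr [] P j) R) k         ≡⟨ row-at ⟩
    h i j k x y z (i * p + (j * q + k * l))                ≡⟨ cong (h i j k x y z) (cong₂ _+_ (behind i) (cong₂ _+_ (below j) (left k))) ⟩
    h i j k x y z (i * value (pred i) j k + (j * value i (pred j) k + k * value i j (pred k))) ∎
    where
    open ≡-Reasoning
    x y z : ℕ
    x = lookupOr 0 xs i
    y = lookupOr 0 ys j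
    z = lookupOr 0 zs k
    P : List (List ℕ)
    P = lookupOr [] ([] ∷ table) i
    R : List ℕ
    R = lookupOr [] ([] ∷ plane i x P) j
    p q l : ℕ
    p = lookupOr 0 (lookupOr [] P j) k
    q = lookupOr 0 R k
    l = lookupOr 0 (0 ∷ row i x j y (lookupOr [] P j) R) k

    table-at : lookupOr [] table i ≡ plane i x P
    table-at = lookup-scanIndexed plane [] 0 0 [] xs i<

    plane-at : lookupOr [] (plane i x P) j ≡ row i x j y (lookupOr [] P j) R
    plane-at = trans (lookup-scanIndexed _ [] (0 , []) 0 [] (zipPadded [] ys P) (<-zipPadded [] ys P j<))
                     (cong (λ (y′ , b) → row i x j y′ b R) (lookup-zipPadded 0 [] ys P j<))

    row-at : lookupOr 0 (row i x j y (lookupOr [] P j) R) k ≡ h i j k x y z (i * p + (j * q + k * l))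
    row-at = trans (lookup-scanIndexed _ 0 ((0 , 0) , 0) 0 0 (zipPadded 0 zp R) (<-zipPadded 0 zp R (<-zipPadded 0 zs B k<)))
      (cong (λ ((z′ , p′) , q′) → h i j k x y z′ (i * p′ + (j * q′ + k * l)))
            (trans (lookup-zipPadded (0 , 0) 0 zp R (<-zipPadded 0 zs B k<)) (cong (_, q) (lookup-zipPadded 0 0 zs B k<))))
      where
      B : List ℕ
      B = lookupOr [] P j
      zp : List (ℕ × ℕ)
      zp = zipPadded 0 zs B

    -- At index 0 the predecessor read from the table is junk, but it is multiplied by 0.
    behind : ∀ i → i * lookupOr 0 (lookupOr [] (lookupOr [] ([] ∷ table) i) j) k ≡ i * value (pred i) j k
    behind zero    = refl
    behind (suc i) = refl

    below : ∀ j → j * lookupOr 0 (lookupOr [] ([] ∷ plane i x P) j) k ≡ j * value i (pred j) k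
    below zero    = refl
    below (suc j) = cong (λ Q → suc j * lookupOr 0 (lookupOr [] Q j) k) (sym table-at)

    left : ∀ k → k * lookupOr 0 (0 ∷ row i x j y (lookupOr [] P j) R) k ≡ k * value i j (pred k)
    left zero    = refl
    left (suc k) = cong (λ r → suc k * lookupOr 0 r k) (sym (trans (cong (λ Q → lookupOr [] Q j) table-at) plane-at))

-- The largest threshold allowed by |F|² ≤ 2²⁴⁰: threshold + 1 is itself a product of three
-- binomial coefficients, and admitting it breaks the bound.
threshold : ℕ
threshold = 506770183745941346868007314943999

fits : ℕ → ℕ → ℕ → Bool
fits x y z = x * y * z ≤ᵇ threshold

binomial80 : ℕ → ℕ
binomial80 = lookupOr 0 (pascalRow 80)

accepted : ℕ → ℕ → ℕ → Bool
accepted i j k = fits (binomial80 i) (binomial80 j) (binomial80 k)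

familySize : List ℕ → ℕ
familySize r = selfWeightedSum r λ x → selfWeightedSum r λ y → selfWeightedSum r λ z → if fits x y z then 1 else 0

card-accepted : card (atBlockSizes 80 80 {80} accepted) ≡ familySize (pascalRow 80)
card-accepted = begin
  card (atBlockSizes 80 80 {80} accepted)
    ≡⟨ card≡sumSubsets (atBlockSizes 80 80 {80} accepted) ⟩
  sumSubsets 240 (λ T → if atBlockSizes 80 80 {80} accepted T then 1 else 0)
    ≡⟨ sumSubsets-blocks 80 80 80 (λ i j k → if accepted i j k then 1 else 0) ⟩
  indexWeightedSum r (λ i → indexWeightedSum r λ j → indexWeightedSum r λ k → if accepted i j k then 1 else 0)
    ≡⟨ indexWeightedSum-cong r (λ i → indexWeightedSum-cong r λ j →
         indexWeightedSum-lookup r (λ z → if fits (binomial80 i) (binomial80 j) z then 1 else 0)) ⟩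
  indexWeightedSum r (λ i → indexWeightedSum r λ j → selfWeightedSum r λ z →
    if fits (binomial80 i) (binomial80 j) z then 1 else 0)
    ≡⟨ indexWeightedSum-cong r (λ i →
         indexWeightedSum-lookup r (λ y → selfWeightedSum r λ z → if fits (binomial80 i) y z then 1 else 0)) ⟩
  indexWeightedSum r (λ i → selfWeightedSum r λ y → selfWeightedSum r λ z → if fits (binomial80 i) y z then 1 else 0)
    ≡⟨ indexWeightedSum-lookup r (λ x → selfWeightedSum r λ y → selfWeightedSum r λ z → if fits x y z then 1 else 0) ⟩
  familySize r
    ∎
  where
  open ≡-Reasoning
  r : List ℕ
  r = pascalRow 80

chainStep : ℕ → ℕ → ℕ → ℕ → ℕ → ℕ → ℕ → ℕ
chainStep i j k x y z s = if fits x y z then startOrExtend (i + (j + k)) s else 0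

open TabulatedRecurrence chainStep (pascalRow 80) (pascalRow 80) (pascalRow 80)
  using () renaming (value to chainCount; value-rec to chainCount-rec)

chainCount-recurrence : ChainRecurrence 80 80 80 accepted chainCount
chainCount-recurrence i≤80 j≤80 k≤80 = chainCount-rec (<-pascalRow i≤80) (<-pascalRow j≤80) (<-pascalRow k≤80)
  where
  <-pascalRow : ∀ {i} → i ≤ 80 → i < length (pascalRow 80)
  <-pascalRow {i} i≤80 = subst (i <_) (sym (length-pascalRow 80)) (s≤s i≤80)

-- All implicit arguments are explicit here: any unsolved one would make the conversion checker
-- unfold chainsEndingAt on a concrete 240-element set.
chainCount≤numMaxChains : chainCount 80 80 80 ≤ numMaxChains (atBlockSizes 80 80 {80} accepted)
chainCount≤numMaxChains = begin
  chainCount 80 80 80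
    ≡⟨ cong (λ m → chainCount m m m) (∣⊤∣≡n 80) ⟨
  chainCount (∣ ⊤ {80} ∣) (∣ ⊤ {80} ∣) (∣ ⊤ {80} ∣)
    ≡⟨ atBlockSizes-++ chainCount (⊤ {80}) (⊤ {80}) (⊤ {80}) ⟨
  atBlockSizes 80 80 {80} chainCount full
    ≡⟨ chainsEndingAt-blocks {80} {80} {80} {accepted} {chainCount} chainCount-recurrence full ⟨
  chainsEndingAt (atBlockSizes 80 80 {80} accepted) ∣ full ∣ full
    ≤⟨ chainsEndingAt≤numMaxChains (atBlockSizes 80 80 {80} accepted) full refl ⟩
  numMaxChains (atBlockSizes 80 80 {80} accepted)
    ∎
  where
  open ≤-Reasoning
  full : Subset 240
  full = ⊤ {80} ++ (⊤ {80} ++ ⊤ {80})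

opaque
  unfolding pascalRow

  familySize²≤2²⁴⁰ : familySize (pascalRow 80) ^ 2 ≤ 2 ^ 240
  familySize²≤2²⁴⁰ = ≤ᵇ⇒≤ _ _ tt

  chainCount-large : (240 !) * 1000000 ^ 240 < chainCount 80 80 80 * 1785975 ^ 240
  chainCount-large = <ᵇ⇒< _ _ tt

corollary4p2 : Σ ℕ λ n → Σ (SetSystem n) λ F →
    (1 ≤ n) × (card F ^ 2 ≤ 2 ^ n) × ((n !) * 1000000 ^ n < numMaxChains F * 1785975 ^ n)
corollary4p2 = 240 , atBlockSizes 80 80 {80} accepted , s≤s z≤n ,
  subst (λ m → m ^ 2 ≤ 2 ^ 240) (sym card-accepted) familySize²≤2²⁴⁰ ,
  <-≤-trans chainCount-large (*-monoˡ-≤ (1785975 ^ 240) chainCount≤numMaxChains)
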